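{- Let $G=(V,E)$ be a finite simple graph and let $A,B\subseteq V$ be two vertex subsets with $A\cap B=C\neq\emptyset$. Then \[ \Delta(G,A,B) < \Delta\bigl(G_{ -C},\,A\setminus C,\,B\setminus C\bigr). \]
   Context: For a finite simple graph $H$, $\sigma(H)$ denotes the number of independent vertex sets of $H$ (subsets of vertices no two of which are adjacent), including the empty set; the graph with no vertices has $\sigma=1$. For a vertex subset $X$, $H_{ -X}$ is the graph obtained from $H$ by deleting all vertices of $X$ together with their incident edges; $H_{ -X-Y}$ means $H_{ -(X\cup Y)}$. For vertex subsets $A,B$ of $H$, define $\Delta(H,A,B)=\sigma(H_{ -A})\cdot\sigma(H_{ -B})-\sigma(H)\cdot\sigma(H_{ -A-B})$. -}

module Defs where

open import Data.Bool using (Bool; true; false; _∧_; _∨_; not; if_then_else_)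
open import Data.Nat using (ℕ; zero; suc)
open import Data.Fin using (Fin)
open import Data.Fin.Subset using (Subset; _─_; inside; outside)
open import Data.Vec using (Vec; []; _∷_; lookup)
open import Data.List using (List; []; _∷_; map; _++_; length; filter; foldr)
open import Data.List.Membership.Propositional using () renaming (_∈_ to _∈ₗ_)
open import Data.Integer using (ℤ; +_; _-_; _*_)
open import Data.List using (allFin)
open import Relation.Binary.PropositionalEquality using (_≡_)
open import Relation.Nullary.Decidable using (T?)
open import Data.Bool using (T)

-- A finite simple graph whose vertex set is a subset  vertices  of Fin n.
-- Adjacency is a symmetric, irreflexive Boolean relation (only its values
-- on pairs of vertices matter).
record Graph (n : ℕ) : Set where
  field
    vertices : Subset n
    adj      : Fin n → Fin n → Bool
    adj-sym  : ∀ i j → adj i j ≡ adj j i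
    adj-irr  : ∀ i → adj i i ≡ false
open Graph public

_-ᵥ_ : ∀ {n} → Graph n → Subset n → Graph n
G -ᵥ X = record
  { vertices = vertices G ─ X
  ; adj = adj G ; adj-sym = adj-sym G ; adj-irr = adj-irr G }

allSubsets : (n : ℕ) → List (Subset n)
allSubsets zero    = [] ∷ []
allSubsets (suc n) = map (outside ∷_) (allSubsets n) ++ map (inside ∷_) (allSubsets n)

allB : {A : Set} → (A → Bool) → List A → Bool
allB p = foldr (λ x b → p x ∧ b) true

subsetOf : ∀ {n} → Subset n → Subset n → Bool
subsetOf []      []      = true
subsetOf (x ∷ s) (y ∷ t) = (not x ∨ y) ∧ subsetOf s t

isIndependent : ∀ {n} → Graph n → Subset n → Bool
isIndependent {n} G S =
  subsetOf S (vertices G) ∧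
  allB (λ i → allB (λ j → not (lookup S i ∧ lookup S j ∧ adj G i j))
                   (allFin n))
       (allFin n)

σ : ∀ {n} → Graph n → ℕ
σ {n} G = length (filter (λ S → T? (isIndependent G S)) (allSubsets n))

Δ : ∀ {n} → Graph n → Subset n → Subset n → ℤ
Δ G A B = (+ σ (G -ᵥ A)) * (+ σ (G -ᵥ B)) - (+ σ G) * (+ σ (G -ᵥ (A Data.Fin.Subset.∪ B)))

-- The three graphs G₋A, G₋B and G₋(A∪B) coincide with the corresponding deletions
-- from G₋C, so Δ(G₋C, A∖C, B∖C) − Δ(G,A,B) = (σ(G) − σ(G₋C))·σ(G₋(A∪B)).
-- The second factor is positive because ∅ is independent, and the first because a
-- singleton {c} with c ∈ C is independent in G but not in G₋C.
module Submission where

open import Defs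
open import Data.Nat using (ℕ)
open import Data.Fin.Subset using (Subset; _⊆_; _∩_; _─_; Nonempty)
open import Data.Integer using (_<_)

open import Data.Bool using (Bool; true; false; T; _∧_; not)
open import Data.Bool.Properties using (T-∧)
open import Data.Empty using (⊥-elim)
open import Data.Fin using (Fin)
open import Data.Fin.Subset using (_∪_; ⁅_⁆; ⊥; _∈_; _∉_; inside; outside)
open import Data.Fin.Subset.Properties
  using (drop-∷-⊆; ⊆-trans; ⊥⊆; ∉⊥; x∈⁅x⁆; x∈⁅y⁆⇒x≡y; p─q⊆p; p∩q⊆p; p∩q⊆q; p⊆p∪q)
open import Data.Integer using (ℤ; +_; +<+; _-_; _*_; positive)
open import Data.Integer.Properties using (+-monoʳ-<; neg-mono-<; *-monoʳ-<-pos; module ≤-Reasoning)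
open import Data.List using (List; []; _∷_; length; filter; allFin)
open import Data.List.Membership.Propositional using () renaming (_∈_ to _∈ₗ_)
open import Data.List.Membership.Propositional.Properties using (∈-map⁺; ∈-++⁺ˡ; ∈-++⁺ʳ)
open import Data.List.Relation.Unary.Any using (here; there)
import Data.Nat as ℕ
open import Data.Nat.Properties using (m≤n⇒m≤1+n)
open import Data.Product using (_,_; proj₁)
open import Data.Vec using (_∷_; []; here; there; lookup)
open import Data.Vec.Properties using (lookup⇒[]=)
open import Function.Bundles using (Equivalence)
open import Relation.Binary.PropositionalEquality using (_≡_; refl; sym; trans; cong; cong₂; subst)
open import Relation.Nullary using (¬_)
open import Relation.Nullary.Decidable using (T?)

private
  variable
    n : ℕ
    E : Set
    p q : E → Bool

-- σ G unfolds definitionally to count (isIndependent G) (allSubsets n).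
count : (E → Bool) → List E → ℕ
count p xs = length (filter (λ x → T? (p x)) xs)

count-mono : (∀ {x} → T (p x) → T (q x)) → (xs : List E) → count p xs ℕ.≤ count q xs
count-mono p⇒q [] = ℕ.z≤n
count-mono {p = p} {q = q} p⇒q (x ∷ xs) with p x | q x | p⇒q {x}
... | true  | true  | _   = ℕ.s≤s (count-mono p⇒q xs)
... | true  | false | px⇒ = ⊥-elim (px⇒ _)
... | false | true  | _   = m≤n⇒m≤1+n (count-mono p⇒q xs)
... | false | false | _   = count-mono p⇒q xs

count-< : (∀ {x} → T (p x) → T (q x)) →
          ∀ {y} (xs : List E) → y ∈ₗ xs → ¬ T (p y) → T (q y) → count p xs ℕ.< count q xs
count-< {p = p} {q = q} p⇒q (x ∷ xs) (here refl) ¬py qy with p x | q x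
... | true  | _    = ⊥-elim (¬py _)
... | false | true = ℕ.s≤s (count-mono p⇒q xs)
count-< {p = p} {q = q} p⇒q (x ∷ xs) (there y∈xs) ¬py qy with p x | q x | p⇒q {x}
... | true  | true  | _   = ℕ.s≤s (count-< p⇒q xs y∈xs ¬py qy)
... | true  | false | px⇒ = ⊥-elim (px⇒ _)
... | false | true  | _   = m≤n⇒m≤1+n (count-< p⇒q xs y∈xs ¬py qy)
... | false | false | _   = count-< p⇒q xs y∈xs ¬py qy

count-pos : ∀ {y} (xs : List E) → y ∈ₗ xs → T (p y) → 0 ℕ.< count p xs
count-pos {p = p} (x ∷ xs) (here refl) py with p x
... | true = ℕ.s≤s ℕ.z≤n
count-pos {p = p} (x ∷ xs) (there y∈xs) py with p x
... | true  = ℕ.s≤s ℕ.z≤n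
... | false = count-pos xs y∈xs py

∈-allSubsets : (S : Subset n) → S ∈ₗ allSubsets n
∈-allSubsets []            = here refl
∈-allSubsets (outside ∷ S) = ∈-++⁺ˡ (∈-map⁺ (outside ∷_) (∈-allSubsets S))
∈-allSubsets (inside ∷ S)  = ∈-++⁺ʳ _ (∈-map⁺ (inside ∷_) (∈-allSubsets S))

subsetOf⇒⊆ : {S W : Subset n} → T (subsetOf S W) → S ⊆ W
subsetOf⇒⊆ {S = inside ∷ S}  {inside ∷ W}  h here         = here
subsetOf⇒⊆ {S = inside ∷ S}  {inside ∷ W}  h (there x∈S)  = there (subsetOf⇒⊆ h x∈S)
subsetOf⇒⊆ {S = outside ∷ S} {w ∷ W}       h (there x∈S)  = there (subsetOf⇒⊆ h x∈S)

⊆⇒subsetOf : {S W : Subset n} → S ⊆ W → T (subsetOf S W)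
⊆⇒subsetOf {S = []}          {[]}    _   = _
⊆⇒subsetOf {S = outside ∷ S} {w ∷ W} S⊆W = ⊆⇒subsetOf (drop-∷-⊆ S⊆W)
⊆⇒subsetOf {S = inside ∷ S}  {w ∷ W} S⊆W with S⊆W here
... | here = ⊆⇒subsetOf (drop-∷-⊆ S⊆W)

allB-intro : (∀ x → T (p x)) → (xs : List E) → T (allB p xs)
allB-intro px []       = _
allB-intro px (x ∷ xs) = Equivalence.from T-∧ (px x , allB-intro px xs)

x∈p─q⇒x∉q : {x : Fin n} {P Q : Subset n} → x ∈ P ─ Q → x ∉ Q
x∈p─q⇒x∉q {P = _ ∷ P} {outside ∷ Q} here          ()
x∈p─q⇒x∉q {P = _ ∷ P} {_ ∷ Q}       (there x∈P─Q) (there x∈Q) = x∈p─q⇒x∉q x∈P─Q x∈Q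

─-─-absorb : (V : Subset n) {C X : Subset n} → C ⊆ X → (V ─ C) ─ (X ─ C) ≡ V ─ X
─-─-absorb []      {[]}          {[]}          _   = refl
─-─-absorb (v ∷ V) {outside ∷ C} {outside ∷ X} C⊆X = cong (v ∷_) (─-─-absorb V (drop-∷-⊆ C⊆X))
─-─-absorb (v ∷ V) {outside ∷ C} {inside ∷ X}  C⊆X = cong (outside ∷_) (─-─-absorb V (drop-∷-⊆ C⊆X))
─-─-absorb (v ∷ V) {inside ∷ C}  {x ∷ X}       C⊆X with C⊆X here
... | here = cong (outside ∷_) (─-─-absorb V (drop-∷-⊆ C⊆X))

─-distribʳ-∪ : (C A B : Subset n) → (A ─ C) ∪ (B ─ C) ≡ (A ∪ B) ─ C
─-distribʳ-∪ []            []      []      = refl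
─-distribʳ-∪ (outside ∷ C) (a ∷ A) (b ∷ B) = cong (_ ∷_) (─-distribʳ-∪ C A B)
─-distribʳ-∪ (inside ∷ C)  (a ∷ A) (b ∷ B) = cong (outside ∷_) (─-distribʳ-∪ C A B)

module _ (G : Graph n) where

  isIndependent-intro : {S : Subset n} → S ⊆ vertices G →
                        (∀ {i j} → i ∈ S → j ∈ S → adj G i j ≡ false) →
                        T (isIndependent G S)
  isIndependent-intro {S} S⊆V nonadjacent =
    Equivalence.from T-∧
      (⊆⇒subsetOf S⊆V , allB-intro (λ i → allB-intro (edgeless i) (allFin n)) (allFin n))
    where
    edgeless : ∀ i j → T (not (lookup S i ∧ lookup S j ∧ adj G i j))
    edgeless i j with lookup S i in i∈S | lookup S j in j∈S
    ... | false | _     = _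
    ... | true  | false = _
    ... | true  | true  rewrite nonadjacent (lookup⇒[]= i S i∈S) (lookup⇒[]= j S j∈S) = _

  isIndependent⇒⊆ : {S : Subset n} → T (isIndependent G S) → S ⊆ vertices G
  isIndependent⇒⊆ {S} indep =
    subsetOf⇒⊆ (proj₁ (Equivalence.to (T-∧ {subsetOf S (vertices G)}) indep))

  isIndependent-⊥ : T (isIndependent G ⊥)
  isIndependent-⊥ = isIndependent-intro ⊥⊆ (λ i∈⊥ → ⊥-elim (∉⊥ i∈⊥))

  isIndependent-⁅⁆ : {x : Fin n} → x ∈ vertices G → T (isIndependent G ⁅ x ⁆)
  isIndependent-⁅⁆ {x} x∈V = isIndependent-intro
    (λ i∈⁅x⁆ → subst (_∈ vertices G) (sym (x∈⁅y⁆⇒x≡y x i∈⁅x⁆)) x∈V)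
    (λ i∈⁅x⁆ j∈⁅x⁆ → trans (cong₂ (adj G) (x∈⁅y⁆⇒x≡y x i∈⁅x⁆) (x∈⁅y⁆⇒x≡y x j∈⁅x⁆)) (adj-irr G x))

  isIndependent-−ᵥ⁻ : {C S : Subset n} → T (isIndependent (G -ᵥ C) S) → T (isIndependent G S)
  isIndependent-−ᵥ⁻ {C} {S} indep with Equivalence.to (T-∧ {subsetOf S (vertices G ─ C)}) indep
  ... | S⊆V─C , edgeless = Equivalence.from (T-∧ {subsetOf S (vertices G)})
    (⊆⇒subsetOf (⊆-trans (subsetOf⇒⊆ {S = S} S⊆V─C) (p─q⊆p (vertices G) C)) , edgeless)

module _ (G : Graph n) where

  σ-pos : 0 ℕ.< σ G
  σ-pos = count-pos (allSubsets n) (∈-allSubsets ⊥) (isIndependent-⊥ G)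

  σ-−ᵥ-< : {C : Subset n} {c : Fin n} → c ∈ C → c ∈ vertices G → σ (G -ᵥ C) ℕ.< σ G
  σ-−ᵥ-< {C} {c} c∈C c∈V =
    count-< (λ {S} → isIndependent-−ᵥ⁻ G {C} {S}) (allSubsets n) (∈-allSubsets ⁅ c ⁆)
            (λ indep → x∈p─q⇒x∉q (isIndependent⇒⊆ (G -ᵥ C) indep (x∈⁅x⁆ c)) c∈C)
            (isIndependent-⁅⁆ G c∈V)

  σ-cong-−ᵥ-−ᵥ : {C Y X : Subset n} → (vertices G ─ C) ─ Y ≡ vertices G ─ X →
                 σ ((G -ᵥ C) -ᵥ Y) ≡ σ (G -ᵥ X)
  σ-cong-−ᵥ-−ᵥ eq = cong (λ W → σ (record G { vertices = W })) eq

  Δ-−ᵥ : {A B C : Subset n} → C ⊆ A → C ⊆ B →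
         Δ (G -ᵥ C) (A ─ C) (B ─ C) ≡
         + σ (G -ᵥ A) * + σ (G -ᵥ B) - + σ (G -ᵥ C) * + σ (G -ᵥ (A ∪ B))
  Δ-−ᵥ {A} {B} {C} C⊆A C⊆B = cong₂ (λ x y → x - + σ (G -ᵥ C) * y)
    (cong₂ (λ a b → + a * + b)
      (σ-cong-−ᵥ-−ᵥ (─-─-absorb (vertices G) C⊆A))
      (σ-cong-−ᵥ-−ᵥ (─-─-absorb (vertices G) C⊆B)))
    (cong +_ (σ-cong-−ᵥ-−ᵥ (trans (cong (vertices G ─ C ─_) (─-distribʳ-∪ C A B))
                                  (─-─-absorb (vertices G) (⊆-trans C⊆A (p⊆p∪q B))))))

proposition2p4 : ∀ {n : ℕ} (G : Graph n) (A B : Subset n) →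
    A ⊆ vertices G → B ⊆ vertices G →
    Nonempty (A ∩ B) →
    Δ G A B < Δ (G -ᵥ (A ∩ B)) (A ─ (A ∩ B)) (B ─ (A ∩ B))
proposition2p4 G A B A⊆V _ (c , c∈A∩B) = begin-strict
  Δ G A B                                    ≡⟨⟩
  ab - + σ G * + σ (G -ᵥ (A ∪ B))             <⟨ +-monoʳ-< ab (neg-mono-< σ-−ᵥ-<-scaled) ⟩
  ab - + σ (G -ᵥ C) * + σ (G -ᵥ (A ∪ B))      ≡⟨ Δ-−ᵥ G (p∩q⊆p A B) (p∩q⊆q A B) ⟨
  Δ (G -ᵥ C) (A ─ C) (B ─ C)                 ∎
  where
  open ≤-Reasoning
  C : Subset _
  C = A ∩ B
  ab : ℤ
  ab = + σ (G -ᵥ A) * + σ (G -ᵥ B)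
  σ-−ᵥ-<-scaled : + σ (G -ᵥ C) * + σ (G -ᵥ (A ∪ B)) < + σ G * + σ (G -ᵥ (A ∪ B))
  σ-−ᵥ-<-scaled = *-monoʳ-<-pos (+ σ (G -ᵥ (A ∪ B))) {{positive (+<+ (σ-pos (G -ᵥ (A ∪ B))))}}
    (+<+ (σ-−ᵥ-< G c∈A∩B (A⊆V (p∩q⊆p A B c∈A∩B))))
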